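{- For finite simple graphs $G_1,G_2,\ldots,G_\ell$, $\operatorname{im}(G_1\circ G_2\circ\cdots\circ G_\ell)\geq \operatorname{im}(G_1)\operatorname{im}(G_2)\cdots\operatorname{im}(G_\ell)$.
   Context: All graphs are finite and simple. A graph $G$ has a $G'$-immersion if there is an injective map $\phi:V(G')\to V(G)$ such that for every edge $uv\in E(G')$ there is a path in $G$ joining $\phi(u)$ and $\phi(v)$, and these paths are pairwise edge-disjoint. The immersion number $\operatorname{im}(G)$ is the largest $t$ such that $G$ has a $K_t$-immersion. The lexicographic product $G\circ H$ has vertex set $V(G)\times V(H)$, with $(g,h)$ adjacent to $(g',h')$ iff $gg'\in E(G)$, or $g=g'$ and $hh'\in E(H)$; the iterated product is $G_1\circ\cdots\circ G_\ell=(G_1\circ\cdots\circ G_{\ell-1})\circ G_\ell$. -}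

module Defs where

open import Data.Nat using (ℕ; zero; suc; _*_; _≤_)
open import Data.Fin using (Fin; _<_; remQuot; inject₁; fromℕ; _≟_)
open import Data.Bool using (Bool; true; false; _∨_; _∧_)
open import Data.Product using (Σ; _×_; _,_; proj₁; proj₂)
open import Data.Sum using (_⊎_)
open import Data.List using (List; []; _∷_; map)
open import Data.List.Membership.Propositional using (_∈_)
open import Data.List.Relation.Unary.Unique.Propositional using (Unique)
open import Relation.Binary.PropositionalEquality using (_≡_; _≢_)
open import Relation.Nullary using (¬_)
open import Relation.Nullary.Decidable using (⌊_⌋)
open import Function.Definitions using (Injective)

record Graph : Set where
  constructor mkGraph
  field
    n   : ℕ
    adj : Fin n → Fin n → Bool
open Graph public

Simple : Graph → Set
Simple G = (∀ u v → adj G u v ≡ adj G v u) × (∀ u → adj G u u ≡ false)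

-- Lexicographic product G ∘ H on Fin (n G * n H), where vertex k stands for
-- the pair remQuot k = (g , h) ∈ V(G) × V(H).
lex : Graph → Graph → Graph
lex G H = mkGraph (n G * n H) λ k k' →
  let (g , h) = remQuot {n G} (n H) k
      (g' , h') = remQuot {n G} (n H) k'
  in adj G g g' ∨ (⌊ g ≟ g' ⌋ ∧ adj H h h')

iterLex : (ℓ : ℕ) → (Fin (suc ℓ) → Graph) → Graph
iterLex zero    Gs = Gs Data.Fin.zero
iterLex (suc ℓ) Gs = lex (iterLex ℓ (λ i → Gs (inject₁ i))) (Gs (fromℕ (suc ℓ)))

iterMul : (ℓ : ℕ) → (Fin (suc ℓ) → ℕ) → ℕ
iterMul zero    ms = ms Data.Fin.zero
iterMul (suc ℓ) ms = iterMul ℓ (λ i → ms (inject₁ i)) * ms (fromℕ (suc ℓ))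

data Walk (G : Graph) : Fin (n G) → Fin (n G) → Set where
  here : ∀ {x} → Walk G x x
  step : ∀ {x y z} → adj G x y ≡ true → Walk G y z → Walk G x z

vertices : ∀ {G x y} → Walk G x y → List (Fin (n G))
vertices {x = x} here = x ∷ []
vertices {x = x} (step _ w) = x ∷ vertices w

edges : ∀ {G x y} → Walk G x y → List (Fin (n G) × Fin (n G))
edges here = []
edges {x = x} (step {y = y} _ w) = (x , y) ∷ edges w

IsPath : ∀ {G x y} → Walk G x y → Set
IsPath w = Unique (vertices w)

SameEdge : ∀ {m} → Fin m × Fin m → Fin m × Fin m → Set
SameEdge (a , b) (c , d) = (a ≡ c × b ≡ d) ⊎ (a ≡ d × b ≡ c)

EdgeDisjoint : ∀ {G x y x' y'} → Walk G x y → Walk G x' y' → Set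
EdgeDisjoint w w' = ∀ {e e'} → e ∈ edges w → e' ∈ edges w' → ¬ SameEdge e e'

-- G has a K_t-immersion: injective φ : V(K_t) = Fin t → V(G) and for each edge
-- ij (i < j) of K_t a path from φ i to φ j, the paths pairwise edge-disjoint.
HasKImmersion : Graph → ℕ → Set
HasKImmersion G t =
  Σ (Fin t → Fin (n G)) λ φ → Injective _≡_ _≡_ φ ×
  Σ (∀ i j → i < j → Walk G (φ i) (φ j)) λ P →
    (∀ i j (p : i < j) → IsPath (P i j p)) ×
    (∀ i j (p : i < j) i' j' (p' : i' < j') → (i , j) ≢ (i' , j') →
       EdgeDisjoint (P i j p) (P i' j' p'))

IsImmersionNumber : Graph → ℕ → Set
IsImmersionNumber G m = HasKImmersion G m × (∀ t → HasKImmersion G t → t ≤ m)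

module Submission where

-- The heart is the two-factor statement (lex-immersion): a K_s-immersion
-- (φ, P) in G and a K_t-immersion (ψ, Q) in H give a K_{st}-immersion in
-- G ∘ H with branch vertices (φ i, ψ a).  Two branch vertices in the same
-- G-fibre (i = i') are joined by the copy of Q a a' inside the fibre of φ i.
-- Branch vertices with i < i' are joined by lifting the G-path P i i' to G ∘ H,
-- giving its vertices the H-labels ψ a, ψ (a ⊕ a'), ψ a, ψ (a ⊕ a'), … and the
-- last vertex ψ a', where ⊕ is addition modulo t.  Since ⊕ is a Latin square,
-- any single edge of such a lift determines (a , a'), so distinct lifts of the
-- same G-path are edge-disjoint; everything else is separated by projecting
-- to G or to H.

open import Defs
open import Data.Nat as ℕ using (ℕ; zero; suc; _+_; _∸_; _*_; _≤_)
open import Data.Nat.Properties using (+-comm; +-assoc; m+[n∸m]≡n; +-cancelˡ-<)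
open import Data.Nat.DivMod using (_%_; _mod_; %-distribˡ-+; m%n%n≡m%n; [m+n]%n≡m%n; m<n⇒m%n≡m)
open import Data.Fin as Fin using (Fin; toℕ; combine; remQuot; inject₁; fromℕ; _≟_)
open import Data.Fin.Properties using (nonZeroIndex; toℕ<n; toℕ≤n; toℕ-fromℕ<; toℕ-injective; remQuot-combine; combine-remQuot; combine-injectiveˡ; combine-injectiveʳ; combine-injective; toℕ-combine; combine-monoˡ-<; <-cmp; <-irrelevant; <⇒≢; <-asym)
open import Data.Bool using (Bool; true; _∨_; _∧_)
open import Data.Bool.Properties using (∨-zeroʳ)
open import Data.Product using (_×_; _,_; proj₁; proj₂)
open import Data.Sum using (_⊎_; inj₁; inj₂; swap)
open import Data.Empty using (⊥-elim)
open import Data.List using ([]; _∷_; map)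
open import Data.List.Membership.Propositional using (_∈_)
open import Data.List.Membership.Propositional.Properties using (∈-map⁺; ∈-map⁻)
open import Data.List.Relation.Unary.Any using (here; there)
open import Data.List.Relation.Unary.All as All using (All)
open import Data.List.Relation.Unary.AllPairs using (_∷_)
open import Data.List.Relation.Unary.Unique.Propositional using (Unique)
import Data.List.Relation.Unary.Unique.Propositional.Properties as Unique
open import Function.Definitions using (Injective)
open import Relation.Binary.PropositionalEquality
open import Relation.Binary.Definitions using (tri<; tri≈; tri>)
open import Relation.Nullary using (¬_; yes; no)
open import Relation.Nullary.Decidable using (⌊_⌋)

-- Addition modulo t on Fin t.  Its table is a Latin square: each argument is
-- determined by the value and the other argument (⊕-cancelˡ, ⊕-determined).
_⊕_ : ∀ {t} → Fin t → Fin t → Fin t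
_⊕_ {t} a b = _mod_ (toℕ a + toℕ b) t {{nonZeroIndex a}}

-- ⊕ is commutative, so right cancellation follows from left cancellation.
⊕-comm : ∀ {t} (a b : Fin t) → a ⊕ b ≡ b ⊕ a
⊕-comm {t} a b = cong (λ m → _mod_ m t {{nonZeroIndex a}}) (+-comm (toℕ a) (toℕ b))

+-mod-recover : ∀ {t} .{{_ : ℕ.NonZero t}} (a b : Fin t) →
                toℕ b ≡ ((toℕ a + toℕ b) % t + (t ∸ toℕ a)) % t
+-mod-recover {t} a b = begin
  toℕ b                                   ≡⟨ m<n⇒m%n≡m (toℕ<n b) ⟨
  toℕ b % t                               ≡⟨ [m+n]%n≡m%n (toℕ b) t ⟨
  (toℕ b + t) % t                         ≡⟨ cong (_% t) b+t≡a+b+[t∸a] ⟩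
  (toℕ a + toℕ b + (t ∸ toℕ a)) % t       ≡⟨ %-distribˡ-+ (toℕ a + toℕ b) (t ∸ toℕ a) t ⟩
  ((toℕ a + toℕ b) % t + r) % t           ≡⟨ cong (λ x → (x + r) % t) (m%n%n≡m%n (toℕ a + toℕ b) t) ⟨
  ((toℕ a + toℕ b) % t % t + r) % t       ≡⟨ %-distribˡ-+ ((toℕ a + toℕ b) % t) (t ∸ toℕ a) t ⟨
  ((toℕ a + toℕ b) % t + (t ∸ toℕ a)) % t ∎
  where
  open ≡-Reasoning
  r : ℕ
  r = (t ∸ toℕ a) % t
  b+t≡a+b+[t∸a] : toℕ b + t ≡ toℕ a + toℕ b + (t ∸ toℕ a)
  b+t≡a+b+[t∸a] = begin
    toℕ b + t                       ≡⟨ cong (toℕ b +_) (m+[n∸m]≡n (toℕ≤n a)) ⟨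
    toℕ b + (toℕ a + (t ∸ toℕ a))   ≡⟨ +-assoc (toℕ b) (toℕ a) _ ⟨
    toℕ b + toℕ a + (t ∸ toℕ a)     ≡⟨ cong (_+ (t ∸ toℕ a)) (+-comm (toℕ b) (toℕ a)) ⟩
    toℕ a + toℕ b + (t ∸ toℕ a)     ∎

⊕-cancelˡ : ∀ {t} (a b b' : Fin t) → a ⊕ b ≡ a ⊕ b' → b ≡ b'
⊕-cancelˡ {t} a b b' eq = toℕ-injective (begin
  toℕ b                                    ≡⟨ +-mod-recover a b ⟩
  ((toℕ a + toℕ b) % t + (t ∸ toℕ a)) % t  ≡⟨ cong (λ x → (x + (t ∸ toℕ a)) % t) sums≡ ⟩
  ((toℕ a + toℕ b') % t + (t ∸ toℕ a)) % t ≡⟨ +-mod-recover a b' ⟨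
  toℕ b'                                   ∎)
  where
  open ≡-Reasoning
  instance _ = nonZeroIndex a
  sums≡ : (toℕ a + toℕ b) % t ≡ (toℕ a + toℕ b') % t
  sums≡ = trans (sym (toℕ-fromℕ< _)) (trans (cong toℕ eq) (toℕ-fromℕ< _))

⊕-determined : ∀ {t} {a a' b b' : Fin t} → a ≡ b ⊎ a' ≡ b' → a ⊕ a' ≡ b ⊕ b' → a ≡ b × a' ≡ b'
⊕-determined {a = a} {a'} {b} {b'} (inj₁ refl) eq = refl , ⊕-cancelˡ a a' b' eq
⊕-determined {a = a} {a'} {b} {b'} (inj₂ refl) eq =
  ⊕-cancelˡ a' a b (trans (⊕-comm a' a) (trans eq (⊕-comm b a'))) , refl

mapᴱ : ∀ {m k} → (Fin m → Fin k) → Fin m × Fin m → Fin k × Fin k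
mapᴱ f (x , y) = f x , f y

SameEdge-map : ∀ {m k} (f : Fin m → Fin k) {e e'} → SameEdge e e' → SameEdge (mapᴱ f e) (mapᴱ f e')
SameEdge-map f (inj₁ (p , q)) = inj₁ (cong f p , cong f q)
SameEdge-map f (inj₂ (p , q)) = inj₂ (cong f p , cong f q)

SameEdge-sym : ∀ {m} {e e' : Fin m × Fin m} → SameEdge e e' → SameEdge e' e
SameEdge-sym (inj₁ (p , q)) = inj₁ (sym p , sym q)
SameEdge-sym (inj₂ (p , q)) = inj₂ (sym q , sym p)

SameEdge-loop : ∀ {m} {g u v : Fin m} → SameEdge (g , g) (u , v) → u ≡ v
SameEdge-loop (inj₁ (p , q)) = trans (sym p) q
SameEdge-loop (inj₂ (p , q)) = trans (sym q) p

SameEdge-loops : ∀ {m} {g h : Fin m} → SameEdge (g , g) (h , h) → g ≡ h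
SameEdge-loops (inj₁ (p , _)) = p
SameEdge-loops (inj₂ (p , _)) = p

module _ {G : Graph} where

  start∈vertices : ∀ {x y} (w : Walk G x y) → x ∈ vertices w
  start∈vertices here = here refl
  start∈vertices (step _ w) = here refl

  edge-endpoints : ∀ {x y u v} (w : Walk G x y) → (u , v) ∈ edges w → u ∈ vertices w × v ∈ vertices w
  edge-endpoints (step _ w) (here refl) = here refl , there (start∈vertices w)
  edge-endpoints (step _ w) (there m) = let u∈ , v∈ = edge-endpoints w m in there u∈ , there v∈

  path-loopless : ∀ {x y u v} (w : Walk G x y) → IsPath w → (u , v) ∈ edges w → u ≢ v
  path-loopless (step _ w) (x∉ ∷ _) (here refl) = All.lookup x∉ (start∈vertices w)
  path-loopless (step _ w) (_ ∷ p) (there m) = path-loopless w p m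

  edge-avoids : ∀ {x y u z e} (w : Walk G x y) → All (u ≢_) (vertices w) → e ∈ edges w → ¬ SameEdge (u , z) e
  edge-avoids w u∉ m se with edge-endpoints w m | se
  ... | a∈ , _ | inj₁ (u≡a , _) = All.lookup u∉ a∈ u≡a
  ... | _ , b∈ | inj₂ (u≡b , _) = All.lookup u∉ b∈ u≡b

module LexProduct (G H : Graph) where

  L : Graph
  L = lex G H

  π₁ : Fin (n L) → Fin (n G)
  π₁ k = proj₁ (remQuot {n G} (n H) k)

  π₂ : Fin (n L) → Fin (n H)
  π₂ k = proj₂ (remQuot {n G} (n H) k)

  π₁-combine : ∀ (g : Fin (n G)) (h : Fin (n H)) → π₁ (combine g h) ≡ g
  π₁-combine g h = cong proj₁ (remQuot-combine g h)

  π₂-combine : ∀ (g : Fin (n G)) (h : Fin (n H)) → π₂ (combine g h) ≡ h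
  π₂-combine g h = cong proj₂ (remQuot-combine g h)

  π₁ᴱ-combine : ∀ (g : Fin (n G)) (h : Fin (n H)) g' h' → mapᴱ π₁ (combine g h , combine g' h') ≡ (g , g')
  π₁ᴱ-combine g h g' h' = cong₂ _,_ (π₁-combine g h) (π₁-combine g' h')

  π₂ᴱ-combine : ∀ (g : Fin (n G)) (h : Fin (n H)) g' h' → mapᴱ π₂ (combine g h , combine g' h') ≡ (h , h')
  π₂ᴱ-combine g h g' h' = cong₂ _,_ (π₂-combine g h) (π₂-combine g' h')

  adj-combine : ∀ (g : Fin (n G)) (h : Fin (n H)) g' h' →
    adj L (combine g h) (combine g' h') ≡ (adj G g g' ∨ (⌊ g ≟ g' ⌋ ∧ adj H h h'))
  adj-combine g h g' h' = cong₂ lexAdj (remQuot-combine {n G} {n H} g h) (remQuot-combine g' h')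
    where
    lexAdj : Fin (n G) × Fin (n H) → Fin (n G) × Fin (n H) → Bool
    lexAdj (g , h) (g' , h') = adj G g g' ∨ (⌊ g ≟ g' ⌋ ∧ adj H h h')

  adj-across : ∀ {g g'} h h' → adj G g g' ≡ true → adj L (combine g h) (combine g' h') ≡ true
  adj-across {g} {g'} h h' gg' rewrite adj-combine g h g' h' | gg' = refl

  adj-within : ∀ g {h h'} → adj H h h' ≡ true → adj L (combine g h) (combine g h') ≡ true
  adj-within g {h} {h'} hh' rewrite adj-combine g h g h' | hh' with g ≟ g
  ... | yes _ = ∨-zeroʳ _
  ... | no g≢g = ⊥-elim (g≢g refl)

  within : ∀ g {x y} → Walk H x y → Walk L (combine g x) (combine g y)
  within g here = here
  within g (step e w) = step (adj-within g e) (within g w)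

  within-vertices : ∀ g {x y} (w : Walk H x y) → vertices (within g w) ≡ map (combine g) (vertices w)
  within-vertices g here = refl
  within-vertices g (step e w) = cong (combine g _ ∷_) (within-vertices g w)

  within-edges : ∀ g {x y} (w : Walk H x y) → edges (within g w) ≡ map (mapᴱ (combine g)) (edges w)
  within-edges g here = refl
  within-edges g (step e w) = cong (_ ∷_) (within-edges g w)

  within-path : ∀ g {x y} (w : Walk H x y) → IsPath w → IsPath (within g w)
  within-path g w p =
    subst Unique (sym (within-vertices g w)) (Unique.map⁺ (combine-injectiveʳ g _ g _) p)

  within-edge : ∀ g {x y} (w : Walk H x y) {f} → f ∈ edges (within g w) →
    mapᴱ π₁ f ≡ (g , g) × mapᴱ π₂ f ∈ edges w
  within-edge g w f∈ with ∈-map⁻ (mapᴱ (combine g)) (subst (_ ∈_) (within-edges g w) f∈)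
  ... | (h , h') , hh'∈ , refl = π₁ᴱ-combine g h g h' , subst (_∈ edges w) (sym (π₂ᴱ-combine g h g h')) hh'∈

  -- The alternating lift of the G-walk  u → v ⋯ y  (given by its first step):
  -- its vertices get the H-labels a, b, a, b, … except the last, which gets z.
  alternate : ∀ (a b z : Fin (n H)) {u v y} → adj G u v ≡ true → Walk G v y →
    Walk L (combine u a) (combine y z)
  alternate a b z e here = step (adj-across a z e) here
  alternate a b z e (step e' w) = step (adj-across a b e) (alternate b a z e' w)

  alternate-vertices : ∀ a b z {u v y} (e : adj G u v ≡ true) (w : Walk G v y) →
    map π₁ (vertices (alternate a b z e w)) ≡ vertices (step e w)
  alternate-vertices a b z {u} {v} e here = cong₂ _∷_ (π₁-combine u a) (cong (_∷ []) (π₁-combine v z))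
  alternate-vertices a b z {u} e (step e' w) = cong₂ _∷_ (π₁-combine u a) (alternate-vertices b a z e' w)

  alternate-edges : ∀ a b z {u v y} (e : adj G u v ≡ true) (w : Walk G v y) →
    map (mapᴱ π₁) (edges (alternate a b z e w)) ≡ edges (step e w)
  alternate-edges a b z {u} {v} e here = cong (_∷ []) (π₁ᴱ-combine u a v z)
  alternate-edges a b z {u} {v} e (step e' w) =
    cong₂ _∷_ (π₁ᴱ-combine u a v b) (alternate-edges b a z e' w)

  alternate-path : ∀ a b z {u v y} (e : adj G u v ≡ true) (w : Walk G v y) →
    IsPath (step e w) → IsPath (alternate a b z e w)
  alternate-path a b z e w p = Unique.map⁻ (subst Unique (sym (alternate-vertices a b z e w)) p)

  alternate-edge : ∀ a b z {u v y} (e : adj G u v ≡ true) (w : Walk G v y) {f} →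
    f ∈ edges (alternate a b z e w) → mapᴱ π₁ f ∈ edges (step e w)
  alternate-edge a b z e w f∈ = subst (_ ∈_) (alternate-edges a b z e w) (∈-map⁺ (mapᴱ π₁) f∈)

  -- What two alternating lifts of the same G-path must have in common if they
  -- share an edge: an edge of  alternate a b z  carries the labels (a , b),
  -- (b , a), (a , z) or (b , z).
  Overlap : (a b z a' b' z' : Fin (n H)) → Set
  Overlap a b z a' b' z' = (a ≡ a' × (b ≡ b' ⊎ z ≡ z')) ⊎ (b ≡ b' × (a ≡ a' ⊎ z ≡ z'))

  over-same-edge : ∀ {u v : Fin (n G)} {a c a' c' : Fin (n H)} → u ≢ v →
    SameEdge (combine u a , combine v c) (combine u a' , combine v c') → a ≡ a' × c ≡ c'
  over-same-edge {u} {v} {a} {c} {a'} {c'} u≢v (inj₁ (p , q)) =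
    combine-injectiveʳ u a u a' p , combine-injectiveʳ v c v c' q
  over-same-edge {u} {v} {a} {c} {a'} {c'} u≢v (inj₂ (p , _)) = ⊥-elim (u≢v (combine-injectiveˡ u a v c' p))

  lift-avoids : ∀ a b z {u : Fin (n G)} {v w' y} (e : adj G v w' ≡ true) (w : Walk G w' y) →
    All (u ≢_) (vertices (step e w)) → ∀ {c x f} →
    f ∈ edges (alternate a b z e w) → ¬ SameEdge (combine u c , x) f
  lift-avoids a b z e w u∉ {c} {x} {f} f∈ se = edge-avoids (step e w) u∉ (alternate-edge a b z e w f∈)
    (subst (λ g → SameEdge (g , π₁ x) (mapᴱ π₁ f)) (π₁-combine _ c) (SameEdge-map π₁ se))

  -- Edge-sharing lifts of one G-path overlap.  The edges are aligned position
  -- by position, since the path visits each vertex once; each step down the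
  -- path swaps the roles of a and b.
  alternate-overlap : ∀ a b z a' b' z' {u v y} (e : adj G u v ≡ true) (w : Walk G v y) →
    IsPath (step e w) → ∀ {f f'} → f ∈ edges (alternate a b z e w) →
    f' ∈ edges (alternate a' b' z' e w) → SameEdge f f' → Overlap a b z a' b' z'
  alternate-overlap a b z a' b' z' e here p (here refl) (here refl) se =
    let a≡a' , z≡z' = over-same-edge (path-loopless {G = G} (step e here) p (here refl)) se
    in inj₁ (a≡a' , inj₂ z≡z')
  alternate-overlap a b z a' b' z' e (step e' w) p (here refl) (here refl) se =
    let a≡a' , b≡b' = over-same-edge (path-loopless {G = G} (step e (step e' w)) p (here refl)) se
    in inj₁ (a≡a' , inj₁ b≡b')
  alternate-overlap a b z a' b' z' e (step e' w) (u∉ ∷ _) (here refl) (there f'∈) se =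
    ⊥-elim (lift-avoids b' a' z' e' w u∉ f'∈ se)
  alternate-overlap a b z a' b' z' e (step e' w) (u∉ ∷ _) (there f∈) (here refl) se =
    ⊥-elim (lift-avoids b a z e' w u∉ f∈ (SameEdge-sym se))
  alternate-overlap a b z a' b' z' e (step e' w) (_ ∷ p) (there f∈) (there f'∈) se =
    swap (alternate-overlap b a z b' a' z' e' w p f∈ f'∈ se)

  -- The alternating lift of a walk between distinct vertices (which therefore
  -- has a first step), with its properties.
  lift : ∀ (a b z : Fin (n H)) {x y} → x ≢ y → Walk G x y → Walk L (combine x a) (combine y z)
  lift a b z x≢y here = ⊥-elim (x≢y refl)
  lift a b z _ (step e w) = alternate a b z e w

  lift-path : ∀ a b z {x y} (x≢y : x ≢ y) (W : Walk G x y) → IsPath W → IsPath (lift a b z x≢y W)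
  lift-path a b z x≢y here _ = ⊥-elim (x≢y refl)
  lift-path a b z _ (step e w) = alternate-path a b z e w

  lift-edge : ∀ a b z {x y} (x≢y : x ≢ y) (W : Walk G x y) {f} →
    f ∈ edges (lift a b z x≢y W) → mapᴱ π₁ f ∈ edges W
  lift-edge a b z x≢y here _ = ⊥-elim (x≢y refl)
  lift-edge a b z _ (step e w) = alternate-edge a b z e w

  lift-overlap : ∀ a b z a' b' z' {x y} (x≢y x≢y' : x ≢ y) (W : Walk G x y) → IsPath W →
    ∀ {f f'} → f ∈ edges (lift a b z x≢y W) → f' ∈ edges (lift a' b' z' x≢y' W) →
    SameEdge f f' → Overlap a b z a' b' z'
  lift-overlap a b z a' b' z' x≢y _ here _ = ⊥-elim (x≢y refl)
  lift-overlap a b z a' b' z' _ _ (step e w) = alternate-overlap a b z a' b' z' e w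

data LexLt {s t : ℕ} (i : Fin s) (a : Fin t) : Fin s → Fin t → Set where
  same : ∀ {a'} → a Fin.< a' → LexLt i a i a'
  diff : ∀ {i' a'} → i Fin.< i' → LexLt i a i' a'

combine-lexLt : ∀ {s t} (i i' : Fin s) (a a' : Fin t) → combine i a Fin.< combine i' a' → LexLt i a i' a'
combine-lexLt {t = t} i i' a a' lt with <-cmp i i'
... | tri< i<i' _ _ = diff i<i'
... | tri≈ _ refl _ = same (+-cancelˡ-< (t * toℕ i) (toℕ a) (toℕ a')
                              (subst₂ ℕ._<_ (toℕ-combine i a) (toℕ-combine i a') lt))
... | tri> _ _ i>i' = ⊥-elim (<-asym lt (combine-monoˡ-< a' a i>i'))

module Coordinates (s t : ℕ) where

  ι₁ : Fin (s * t) → Fin s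
  ι₁ k = proj₁ (remQuot {s} t k)

  ι₂ : Fin (s * t) → Fin t
  ι₂ k = proj₂ (remQuot {s} t k)

  ι-injective : ∀ {k k'} → ι₁ k ≡ ι₁ k' → ι₂ k ≡ ι₂ k' → k ≡ k'
  ι-injective {k} {k'} p q = begin
    k                       ≡⟨ combine-remQuot {s} t k ⟨
    combine (ι₁ k) (ι₂ k)   ≡⟨ cong₂ combine p q ⟩
    combine (ι₁ k') (ι₂ k') ≡⟨ combine-remQuot {s} t k' ⟩
    k'                      ∎
    where open ≡-Reasoning

  ι-lexLt : ∀ {k k'} → k Fin.< k' → LexLt (ι₁ k) (ι₂ k) (ι₁ k') (ι₂ k')
  ι-lexLt {k} {k'} lt = combine-lexLt _ _ _ _
    (subst₂ Fin._<_ (sym (combine-remQuot {s} t k)) (sym (combine-remQuot {s} t k')) lt)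

module ProductImmersion {G H : Graph} {s t : ℕ} (IG : HasKImmersion G s) (IH : HasKImmersion H t) where
  open LexProduct G H
  open Coordinates s t

  φ : Fin s → Fin (n G)
  φ = proj₁ IG

  φ-injective : Injective _≡_ _≡_ φ
  φ-injective = proj₁ (proj₂ IG)

  P : ∀ i i' → i Fin.< i' → Walk G (φ i) (φ i')
  P = proj₁ (proj₂ (proj₂ IG))

  P-path : ∀ i i' (lt : i Fin.< i') → IsPath (P i i' lt)
  P-path = proj₁ (proj₂ (proj₂ (proj₂ IG)))

  P-disjoint : ∀ i i' (lt : i Fin.< i') j j' (lt' : j Fin.< j') → (i , i') ≢ (j , j') →
    EdgeDisjoint (P i i' lt) (P j j' lt')
  P-disjoint = proj₂ (proj₂ (proj₂ (proj₂ IG)))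

  ψ : Fin t → Fin (n H)
  ψ = proj₁ IH

  ψ-injective : Injective _≡_ _≡_ ψ
  ψ-injective = proj₁ (proj₂ IH)

  Q : ∀ a a' → a Fin.< a' → Walk H (ψ a) (ψ a')
  Q = proj₁ (proj₂ (proj₂ IH))

  Q-path : ∀ a a' (lt : a Fin.< a') → IsPath (Q a a' lt)
  Q-path = proj₁ (proj₂ (proj₂ (proj₂ IH)))

  Q-disjoint : ∀ a a' (lt : a Fin.< a') b b' (lt' : b Fin.< b') → (a , a') ≢ (b , b') →
    EdgeDisjoint (Q a a' lt) (Q b b' lt')
  Q-disjoint = proj₂ (proj₂ (proj₂ (proj₂ IH)))

  φ-distinct : ∀ {i i'} → i Fin.< i' → φ i ≢ φ i'
  φ-distinct lt eq = <⇒≢ lt (φ-injective eq)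

  χ : Fin s → Fin t → Fin (n L)
  χ i a = combine (φ i) (ψ a)

  across : ∀ {i i'} (a a' : Fin t) (lt : i Fin.< i') → Walk L (χ i a) (χ i' a')
  across {i} {i'} a a' lt = lift (ψ a) (ψ (a ⊕ a')) (ψ a') (φ-distinct lt) (P i i' lt)

  R : ∀ {i a i' a'} → LexLt i a i' a' → Walk L (χ i a) (χ i' a')
  R {i} (same lt) = within (φ i) (Q _ _ lt)
  R {a = a} {a' = a'} (diff lt) = across a a' lt

  R-path : ∀ {i a i' a'} (r : LexLt i a i' a') → IsPath (R r)
  R-path {i} (same lt) = within-path (φ i) (Q _ _ lt) (Q-path _ _ lt)
  R-path {i} {i' = i'} (diff lt) = lift-path _ _ _ (φ-distinct lt) (P i i' lt) (P-path i i' lt)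

  overlap-labels : ∀ {a a' b b'} → Overlap (ψ a) (ψ (a ⊕ a')) (ψ a') (ψ b) (ψ (b ⊕ b')) (ψ b') →
    a ≡ b × a' ≡ b'
  overlap-labels (inj₁ (p , inj₁ q)) = ⊕-determined (inj₁ (ψ-injective p)) (ψ-injective q)
  overlap-labels (inj₁ (p , inj₂ q)) = ψ-injective p , ψ-injective q
  overlap-labels (inj₂ (q , inj₁ p)) = ⊕-determined (inj₁ (ψ-injective p)) (ψ-injective q)
  overlap-labels (inj₂ (q , inj₂ p)) = ⊕-determined (inj₂ (ψ-injective p)) (ψ-injective q)

  -- Routes inside fibres: in different fibres they lie over different loops of
  -- G; in the same fibre they project to edge-disjoint paths Q of H.
  within-within-disjoint : ∀ {i a a' j b b'} (lt : a Fin.< a') (lt' : b Fin.< b') →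
    ¬ (i ≡ j × a ≡ b × a' ≡ b') → EdgeDisjoint (within (φ i) (Q a a' lt)) (within (φ j) (Q b b' lt'))
  within-within-disjoint {i} {a} {a'} {j} {b} {b'} lt lt' distinct f∈ f'∈ se
    with within-edge (φ i) (Q _ _ lt) f∈ | within-edge (φ j) (Q _ _ lt') f'∈ | i ≟ j
  ... | over-i , _ | over-j , _ | no i≢j =
    i≢j (φ-injective (SameEdge-loops (subst₂ SameEdge over-i over-j (SameEdge-map π₁ se))))
  ... | _ , e∈ | _ , e'∈ | yes refl =
    Q-disjoint a a' lt b b' lt' (λ eq → distinct (refl , cong proj₁ eq , cong proj₂ eq))
      e∈ e'∈ (SameEdge-map π₂ se)

  -- A route inside a fibre and a route between fibres share no edge: the former
  -- lies over loops of G, the latter over edges of a G-path.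
  within-across-disjoint : ∀ {i a a' j j'} b b' (lt : a Fin.< a') (lt' : j Fin.< j') →
    EdgeDisjoint (within (φ i) (Q a a' lt)) (across b b' lt')
  within-across-disjoint {i} {j = j} {j'} b b' lt lt' f∈ f'∈ se =
    path-loopless (P j j' lt') (P-path j j' lt') (lift-edge _ _ _ (φ-distinct lt') (P j j' lt') f'∈)
      (SameEdge-loop (subst (λ e → SameEdge e _) over-loop (SameEdge-map π₁ se)))
    where
    over-loop : mapᴱ π₁ _ ≡ (φ i , φ i)
    over-loop = proj₁ (within-edge (φ i) (Q _ _ lt) f∈)

  -- Lifts of different G-paths lie over edge-disjoint paths of G.
  across-different-paths : ∀ {i i' j j'} a a' b b' (lt : i Fin.< i') (lt' : j Fin.< j') →
    (i , i') ≢ (j , j') → EdgeDisjoint (across a a' lt) (across b b' lt')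
  across-different-paths {i} {i'} {j} {j'} a a' b b' lt lt' ii'≢jj' f∈ f'∈ se =
    P-disjoint i i' lt j j' lt' ii'≢jj' (lift-edge _ _ _ _ _ f∈) (lift-edge _ _ _ _ _ f'∈) (SameEdge-map π₁ se)

  -- Routes between fibres: lifts of different G-paths are disjoint as above;
  -- lifts of the same G-path share an edge only if they carry the same labels,
  -- by the Latin square property.
  across-across-disjoint : ∀ {i i' j j'} a a' b b' (lt : i Fin.< i') (lt' : j Fin.< j') →
    ¬ (i ≡ j × a ≡ b × i' ≡ j' × a' ≡ b') → EdgeDisjoint (across a a' lt) (across b b' lt')
  across-across-disjoint {i} {i'} {j} {j'} a a' b b' lt lt' distinct with i ≟ j | i' ≟ j'
  ... | no i≢j | _ = across-different-paths a a' b b' lt lt' (λ eq → i≢j (cong proj₁ eq))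
  ... | yes _ | no i'≢j' = across-different-paths a a' b b' lt lt' (λ eq → i'≢j' (cong proj₂ eq))
  ... | yes refl | yes refl with <-irrelevant lt lt'
  ... | refl = λ f∈ f'∈ se →
    let a≡b , a'≡b' = overlap-labels (lift-overlap _ _ _ _ _ _ _ _ (P i i' lt) (P-path i i' lt) f∈ f'∈ se)
    in distinct (refl , a≡b , refl , a'≡b')

  R-disjoint : ∀ {i a i' a' j b j' b'} (r : LexLt i a i' a') (r' : LexLt j b j' b') →
    ¬ (i ≡ j × a ≡ b × i' ≡ j' × a' ≡ b') → EdgeDisjoint (R r) (R r')
  R-disjoint (same lt) (same lt') distinct =
    within-within-disjoint lt lt' (λ (i≡j , a≡b , a'≡b') → distinct (i≡j , a≡b , i≡j , a'≡b'))
  R-disjoint (same lt) (diff lt') _ = within-across-disjoint _ _ lt lt'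
  R-disjoint (diff lt) (same lt') _ f∈ f'∈ se = within-across-disjoint _ _ lt' lt f'∈ f∈ (SameEdge-sym se)
  R-disjoint (diff lt) (diff lt') distinct = across-across-disjoint _ _ _ _ lt lt' distinct

  immersion : HasKImmersion L (s * t)
  immersion =
      (λ k → χ (ι₁ k) (ι₂ k))
    , (λ {k} {k'} eq → let p , q = combine-injective _ _ _ _ eq in ι-injective (φ-injective p) (ψ-injective q))
    , (λ k k' lt → R (ι-lexLt lt))
    , (λ k k' lt → R-path (ι-lexLt lt))
    , (λ k₁ k₁' lt₁ k₂ k₂' lt₂ k≢k' → R-disjoint (ι-lexLt lt₁) (ι-lexLt lt₂)
         (λ (p , q , p' , q') → k≢k' (cong₂ _,_ (ι-injective p q) (ι-injective p' q'))))

lex-immersion : ∀ {G H s t} → HasKImmersion G s → HasKImmersion H t → HasKImmersion (lex G H) (s * t)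
lex-immersion IG IH = ProductImmersion.immersion IG IH

iterLex-immersion : ∀ ℓ (Gs : Fin (suc ℓ) → Graph) (ms : Fin (suc ℓ) → ℕ) →
  (∀ i → HasKImmersion (Gs i) (ms i)) → HasKImmersion (iterLex ℓ Gs) (iterMul ℓ ms)
iterLex-immersion zero Gs ms I = I Fin.zero
iterLex-immersion (suc ℓ) Gs ms I =
  lex-immersion (iterLex-immersion ℓ (λ i → Gs (inject₁ i)) (λ i → ms (inject₁ i)) (λ i → I (inject₁ i)))
                (I (fromℕ (suc ℓ)))

corollary5 : (ℓ : ℕ) (Gs : Fin (suc ℓ) → Graph) → (∀ i → Simple (Gs i)) →
    (ms : Fin (suc ℓ) → ℕ) → (∀ i → IsImmersionNumber (Gs i) (ms i)) →
    (M : ℕ) → IsImmersionNumber (iterLex ℓ Gs) M →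
    iterMul ℓ ms ≤ M
corollary5 ℓ Gs _ ms im M (_ , maximal) =
  maximal (iterMul ℓ ms) (iterLex-immersion ℓ Gs ms (λ i → proj₁ (im i)))
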